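{- Let $V$ be a finite non-empty set and let $T:\mathscr{P}(V)\to\mathscr{P}(V)$ be a map. Suppose $(E_1,E_2)$ is a pair of equivalence relations on $V$ with $T(X)=\mathbf{l}_{E_2}(\mathbf{l}_{E_1}(X))$ for all $X\subseteq V$. Then $(E_1,E_2)$ is the unique such pair (i.e. there is no other pair $(E_1',E_2')\neq(E_1,E_2)$ of equivalence relations on $V$ with $T(X)=\mathbf{l}_{E_2'}(\mathbf{l}_{E_1'}(X))$ for all $X$) if and only if all of the following hold: (i) for all $E_2$-classes $[x]_{E_2}\neq[y]_{E_2}$ we have $\mathbf{u}_{E_1}([x]_{E_2})\neq\mathbf{u}_{E_1}([y]_{E_2})$; (ii) for all $E_1$-classes $[x]_{E_1}\neq[y]_{E_1}$ we have $\mathbf{u}_{E_2}([x]_{E_1})\neq\mathbf{u}_{E_2}([y]_{E_1})$; (iii) for every $E_2$-class $[x]_{E_2}$ there is an $E_1$-class $[z]_{E_1}$ with $|[x]_{E_2}\cap[z]_{E_1}|=1$; (iv) for every $E_1$-class $[x]_{E_1}$ there is an $E_2$-class $[z]_{E_2}$ with $|[x]_{E_1}\cap[z]_{E_2}|=1$.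
   Context: For an equivalence relation $E$ on $V$ and $X\subseteq V$, the lower approximation is $\mathbf{l}_E(X)=\{x\in V: [x]_E\subseteq X\}$ and the upper approximation is $\mathbf{u}_E(X)=\{x\in V:[x]_E\cap X\neq\emptyset\}$, where $[x]_E$ is the $E$-class of $x$. -}

module Defs where

open import Data.Nat using (ℕ)
open import Data.Bool using (Bool; true; false; _∧_; _∨_; not)
open import Data.Fin using (Fin)
open import Data.Vec using (tabulate; lookup; foldr′)
open import Data.Fin.Subset using (Subset)
open import Relation.Binary.PropositionalEquality using (_≡_)

BRel : ℕ → Set
BRel n = Fin n → Fin n → Bool

record IsEquivRel {n : ℕ} (E : BRel n) : Set where
  field
    reflE  : ∀ x → E x x ≡ true
    symE   : ∀ x y → E x y ≡ true → E y x ≡ true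
    transE : ∀ x y z → E x y ≡ true → E y z ≡ true → E x z ≡ true

SameRel : {n : ℕ} → BRel n → BRel n → Set
SameRel E E' = ∀ x y → E x y ≡ E' x y

allB : {n : ℕ} → (Fin n → Bool) → Bool
allB f = foldr′ _∧_ true (tabulate f)

anyB : {n : ℕ} → (Fin n → Bool) → Bool
anyB f = foldr′ _∨_ false (tabulate f)

cls : {n : ℕ} → BRel n → Fin n → Subset n
cls E x = tabulate (λ y → E x y)

lower : {n : ℕ} → BRel n → Subset n → Subset n
lower E X = tabulate (λ x → allB (λ y → not (E x y) ∨ lookup X y))

upper : {n : ℕ} → BRel n → Subset n → Subset n
upper E X = tabulate (λ x → anyB (λ y → E x y ∧ lookup X y))

-- A point x lies in l_{E₂}(l_{E₁}(X)) iff u_{E₁}([x]_{E₂}) ⊆ X, so T determines, and is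
-- determined by, the map  reach x = u_{E₁}([x]_{E₂}); the question is which pairs of
-- equivalences produce a given reach map. Coarsening E₂ to the kernel of reach does not
-- change reach, so uniqueness forces (i). If some E₂-class C meets no E₁-class in exactly
-- one point, splitting C into the least elements of the traces [z]_{E₁} ∩ C and the rest
-- does not change reach either, so uniqueness forces (iii). Conversely, for any other pair
-- (F₁, F₂) with the same reach, (i) gives F₂ ⊆ E₂, and then the unique point w of
-- [x]_{E₂} ∩ [z]_{E₁} provided by (iii) is F₂-related to every point of [x]_{E₂}, so
-- E₂ ⊆ F₂. Conditions (ii) and (iv) are the same statements with the roles of E₁ and E₂
-- swapped, because z ∈ u_{E₁}([x]_{E₂}) iff x ∈ u_{E₂}([z]_{E₁}).
module Submission where

open import Defs
open import Data.Nat using (ℕ; suc; zero; s≤s) renaming (_≟_ to _≟ℕ_)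
open import Data.Nat.Properties using (suc-injective)
open import Data.Fin using (Fin; zero; suc; _<_; _<?_)
open import Data.Fin.Properties using (_≟_; <-cmp; all?; any?; ¬∀⟶∃¬)
open import Data.Fin.Subset using (Subset; _∩_; ∣_∣; _∈_; _⊆_; ⁅_⁆; ⊥)
open import Data.Fin.Subset.Properties
  using (_∈?_; ⊆-antisym; x∈⁅x⁆; x∈⁅y⁆⇒x≡y; ∣⁅x⁆∣≡1; x∈p∩q⁺; x∈p∩q⁻)
open import Data.Bool using (Bool; true; false; _∧_; _∨_; not)
open import Data.Bool.Properties using () renaming (_≟_ to _≟ᵇ_)
open import Data.Vec using (_∷_; []; lookup; tabulate)
open import Data.Vec.Properties
  using (lookup∘tabulate; tabulate-cong; []=⇒lookup; lookup⇒[]=; ≡-dec)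
open import Data.Product using (_×_; Σ; ∃; _,_; proj₁; proj₂)
open import Data.Sum using (_⊎_; inj₁; inj₂)
open import Function using (_∘_; const; id)
open import Function.Bundles using (_⇔_; mk⇔; Equivalence)
open import Relation.Binary using (DecidableEquality; tri<; tri≈; tri>)
open import Relation.Binary.PropositionalEquality
open import Relation.Nullary using (¬_; Dec; does; yes; no; contradiction)
open import Relation.Nullary.Decidable
  using (dec-true; dec-false; decidable-stable; _×-dec_; _→-dec_; ¬?)
open IsEquivRel

private
  variable
    n : ℕ
    a b : Bool

∧-true⁻ : a ∧ b ≡ true → a ≡ true × b ≡ true
∧-true⁻ {true} {true} refl = refl , refl

∧-true⁺ : a ≡ true → b ≡ true → a ∧ b ≡ true
∧-true⁺ refl refl = refl

∨-true⁻ : a ∨ b ≡ true → a ≡ true ⊎ b ≡ true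
∨-true⁻ {true}  _ = inj₁ refl
∨-true⁻ {false} h = inj₂ h

∨-trueˡ : a ≡ true → a ∨ b ≡ true
∨-trueˡ refl = refl

∨-trueʳ : b ≡ true → a ∨ b ≡ true
∨-trueʳ {a = true}  _ = refl
∨-trueʳ {a = false} h = h

not∨-true⁻ : not a ∨ b ≡ true → a ≡ true → b ≡ true
not∨-true⁻ h refl = h

≡true⇔≡true⇒≡ : (a ≡ true → b ≡ true) → (b ≡ true → a ≡ true) → a ≡ b
≡true⇔≡true⇒≡ {true}  f _ = sym (f refl)
≡true⇔≡true⇒≡ {false} {true}  _ g = g refl
≡true⇔≡true⇒≡ {false} {false} _ _ = refl

does≡true⇒ : {A : Set} (a? : Dec A) → does a? ≡ true → A
does≡true⇒ (yes a) _ = a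

allB⁻ : (f : Fin n → Bool) → allB f ≡ true → ∀ i → f i ≡ true
allB⁻ f h zero    = proj₁ (∧-true⁻ h)
allB⁻ f h (suc i) = allB⁻ (f ∘ suc) (proj₂ (∧-true⁻ {f zero} h)) i

allB⁺ : (f : Fin n → Bool) → (∀ i → f i ≡ true) → allB f ≡ true
allB⁺ {zero}  f h = refl
allB⁺ {suc n} f h = ∧-true⁺ (h zero) (allB⁺ (f ∘ suc) (h ∘ suc))

anyB⁻ : (f : Fin n → Bool) → anyB f ≡ true → ∃ λ i → f i ≡ true
anyB⁻ {suc n} f h with ∨-true⁻ {f zero} h
... | inj₁ f₀ = zero , f₀
... | inj₂ fₛ with anyB⁻ (f ∘ suc) fₛ
...   | i , fᵢ = suc i , fᵢ

anyB⁺ : (f : Fin n → Bool) (i : Fin n) → f i ≡ true → anyB f ≡ true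
anyB⁺ f zero    h = ∨-trueˡ h
anyB⁺ f (suc i) h = ∨-trueʳ {a = f zero} (anyB⁺ (f ∘ suc) i h)

least : {P : Fin n → Set} → (∀ v → Dec (P v)) → {w : Fin n} → P w →
        ∃ λ k → P k × (∀ {v} → v < k → ¬ P v)
least P? {zero} pw = zero , pw , λ ()
least P? {suc w} pw with P? zero
... | yes p₀ = zero , p₀ , λ ()
... | no ¬p₀ with least (P? ∘ suc) pw
...   | k , pₖ , below = suc k , pₖ , λ { {zero} _ → ¬p₀ ; {suc v} (s≤s v<k) → below v<k }

∣p∣≡0⇒p≡⊥ : {p : Subset n} → ∣ p ∣ ≡ 0 → p ≡ ⊥
∣p∣≡0⇒p≡⊥ {p = []}         _ = refl
∣p∣≡0⇒p≡⊥ {p = false ∷ p} h = cong (false ∷_) (∣p∣≡0⇒p≡⊥ h)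

∣p∣≡1⇒p≡⁅x⁆ : {p : Subset n} → ∣ p ∣ ≡ 1 → ∃ λ x → p ≡ ⁅ x ⁆
∣p∣≡1⇒p≡⁅x⁆ {p = true ∷ p}  h = zero , cong (true ∷_) (∣p∣≡0⇒p≡⊥ (suc-injective h))
∣p∣≡1⇒p≡⁅x⁆ {p = false ∷ p} h with ∣p∣≡1⇒p≡⁅x⁆ h
... | x , p≡⁅x⁆ = suc x , cong (false ∷_) p≡⁅x⁆

∣p∣≢1⇒∈-≢ : {p : Subset n} → ∣ p ∣ ≢ 1 → {x : Fin n} → x ∈ p → ∃ λ y → y ∈ p × y ≢ x
∣p∣≢1⇒∈-≢ {n} {p} ∣p∣≢1 {x} x∈p with ¬∀⟶∃¬ n _ (λ y → y ∈? p →-dec y ≟ x) onlyX⇒⊥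
  where
  onlyX⇒⊥ : ¬ (∀ y → y ∈ p → y ≡ x)
  onlyX⇒⊥ onlyX = ∣p∣≢1 (subst (λ q → ∣ q ∣ ≡ 1) (sym p≡⁅x⁆) (∣⁅x⁆∣≡1 x))
    where
    p≡⁅x⁆ : p ≡ ⁅ x ⁆
    p≡⁅x⁆ = ⊆-antisym (λ {y} y∈p → subst (_∈ ⁅ x ⁆) (sym (onlyX y y∈p)) (x∈⁅x⁆ x))
                       (λ {y} y∈⁅x⁆ → subst (_∈ p) (sym (x∈⁅y⁆⇒x≡y x y∈⁅x⁆)) x∈p)
... | y , ¬onlyX =
  y , decidable-stable (y ∈? p) (λ y∉p → ¬onlyX (λ y∈p → contradiction y∈p y∉p))
    , λ y≡x → ¬onlyX (const y≡x)

_≟ˢ_ : DecidableEquality (Subset n)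
_≟ˢ_ = ≡-dec _≟ᵇ_

module _ {f : Fin n → Bool} {x : Fin n} where

  ∈-tabulate⁻ : x ∈ tabulate f → f x ≡ true
  ∈-tabulate⁻ x∈ = trans (sym (lookup∘tabulate f x)) ([]=⇒lookup x∈)

  ∈-tabulate⁺ : f x ≡ true → x ∈ tabulate f
  ∈-tabulate⁺ h = lookup⇒[]= x _ (trans (lookup∘tabulate f x) h)

module _ {E : BRel n} {x : Fin n} where

  ∈-lower⁻ : {X : Subset n} → x ∈ lower E X → ∀ {y} → E x y ≡ true → y ∈ X
  ∈-lower⁻ x∈ {y} Exy = lookup⇒[]= y _ (not∨-true⁻ (allB⁻ _ (∈-tabulate⁻ x∈) y) Exy)

  ∈-lower⁺ : {X : Subset n} → (∀ y → E x y ≡ true → y ∈ X) → x ∈ lower E X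
  ∈-lower⁺ {X} h = ∈-tabulate⁺ (allB⁺ _ impl)
    where
    impl : ∀ y → not (E x y) ∨ lookup X y ≡ true
    impl y with E x y in Exy
    ... | true  = []=⇒lookup (h y Exy)
    ... | false = refl

  ∈-upper⁻ : {X : Subset n} → x ∈ upper E X → ∃ λ y → E x y ≡ true × y ∈ X
  ∈-upper⁻ x∈ with anyB⁻ _ (∈-tabulate⁻ x∈)
  ... | y , h = y , proj₁ (∧-true⁻ h) , lookup⇒[]= y _ (proj₂ (∧-true⁻ {E x y} h))

  ∈-upper⁺ : {X : Subset n} {y : Fin n} → E x y ≡ true → y ∈ X → x ∈ upper E X
  ∈-upper⁺ {y = y} Exy y∈X = ∈-tabulate⁺ (anyB⁺ _ y (∧-true⁺ Exy ([]=⇒lookup y∈X)))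

module _ {E : BRel n} (e : IsEquivRel E) where

  cls-cong : ∀ {x y} → E x y ≡ true → cls E x ≡ cls E y
  cls-cong {x} {y} Exy =
    tabulate-cong (λ z → ≡true⇔≡true⇒≡ (transE e y x z (symE e x y Exy)) (transE e x y z Exy))

  cls-injective : ∀ {x y} → cls E x ≡ cls E y → E x y ≡ true
  cls-injective {x} {y} eq = ∈-tabulate⁻ (subst (y ∈_) (sym eq) (∈-tabulate⁺ (reflE e y)))

_⊆ᴿ_ : BRel n → BRel n → Set
F ⊆ᴿ E = ∀ {u v} → F u v ≡ true → E u v ≡ true

⊆ᴿ-antisym : {F E : BRel n} → F ⊆ᴿ E → E ⊆ᴿ F → SameRel F E
⊆ᴿ-antisym F⊆E E⊆F x y = ≡true⇔≡true⇒≡ F⊆E E⊆F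

∧-isEquiv : {E F : BRel n} → IsEquivRel E → IsEquivRel F → IsEquivRel (λ u v → E u v ∧ F u v)
∧-isEquiv e f = record
  { reflE  = λ u → ∧-true⁺ (reflE e u) (reflE f u)
  ; symE   = λ u v h → let h₁ , h₂ = ∧-true⁻ h in ∧-true⁺ (symE e u v h₁) (symE f u v h₂)
  ; transE = λ u v w h k → let h₁ , h₂ = ∧-true⁻ h ; k₁ , k₂ = ∧-true⁻ k in
                           ∧-true⁺ (transE e u v w h₁ k₁) (transE f u v w h₂ k₂)
  }

module _ {A : Set} (_≟ᴬ_ : DecidableEquality A) (f : Fin n → A) where

  kernel : BRel n
  kernel u v = does (f u ≟ᴬ f v)

  kernel⁺ : ∀ {u v} → f u ≡ f v → kernel u v ≡ true
  kernel⁺ {u} {v} = dec-true (f u ≟ᴬ f v)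

  kernel⁻ : ∀ {u v} → kernel u v ≡ true → f u ≡ f v
  kernel⁻ {u} {v} = does≡true⇒ (f u ≟ᴬ f v)

  kernel-isEquiv : IsEquivRel kernel
  kernel-isEquiv = record
    { reflE  = λ u → kernel⁺ refl
    ; symE   = λ u v h → kernel⁺ (sym (kernel⁻ h))
    ; transE = λ u v w h k → kernel⁺ (trans (kernel⁻ h) (kernel⁻ k))
    }

reach : BRel n → BRel n → Fin n → Subset n
reach F₁ F₂ x = upper F₁ (cls F₂ x)

module _ {F₁ : BRel n} (F₂ : BRel n) (x : Fin n) {z : Fin n} where

  ∈-reach⁻ : z ∈ reach F₁ F₂ x → ∃ λ y → F₂ x y ≡ true × F₁ z y ≡ true
  ∈-reach⁻ z∈ with ∈-upper⁻ z∈
  ... | y , F₁zy , y∈cls = y , ∈-tabulate⁻ y∈cls , F₁zy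

  ∈-reach⁺ : ∀ {y} → F₂ x y ≡ true → F₁ z y ≡ true → z ∈ reach F₁ F₂ x
  ∈-reach⁺ F₂xy F₁zy = ∈-upper⁺ F₁zy (∈-tabulate⁺ F₂xy)

reach-flip : {F₁ F₂ : BRel n} {x z : Fin n} → z ∈ reach F₁ F₂ x → x ∈ reach F₂ F₁ z
reach-flip {F₁ = F₁} {F₂} {x} {z} z∈ =
  let y , F₂xy , F₁zy = ∈-reach⁻ F₂ x z∈ in ∈-reach⁺ F₁ z F₁zy F₂xy

reach-mono : (F₁ F₂ G₂ : BRel n) → F₂ ⊆ᴿ G₂ → ∀ x → reach F₁ F₂ x ⊆ reach F₁ G₂ x
reach-mono F₁ F₂ G₂ F₂⊆G₂ x z∈ =
  let y , F₂xy , F₁zy = ∈-reach⁻ F₂ x z∈ in ∈-reach⁺ G₂ x (F₂⊆G₂ F₂xy) F₁zy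

reach-cong : {F₁ F₂ : BRel n} → IsEquivRel F₂ → ∀ {x y} → F₂ x y ≡ true →
             reach F₁ F₂ x ≡ reach F₁ F₂ y
reach-cong {F₁ = F₁} f₂ F₂xy = cong (upper F₁) (cls-cong f₂ F₂xy)

SameReach : BRel n → BRel n → BRel n → BRel n → Set
SameReach F₁ F₂ E₁ E₂ = ∀ x → reach F₁ F₂ x ≡ reach E₁ E₂ x

SameReach-flip : {F₁ F₂ E₁ E₂ : BRel n} → SameReach F₁ F₂ E₁ E₂ → SameReach F₂ F₁ E₂ E₁
SameReach-flip same z = ⊆-antisym (flipVia same) (flipVia (sym ∘ same))
  where
  flipVia : ∀ {G₁ G₂ H₁ H₂} → SameReach G₁ G₂ H₁ H₂ → reach G₂ G₁ z ⊆ reach H₂ H₁ z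
  flipVia eq {x} x∈ = reach-flip (subst (z ∈_) (eq x) (reach-flip x∈))

module _ {F₁ F₂ : BRel n} (f₁ : IsEquivRel F₁) {x : Fin n} {X : Subset n} where

  ∈-lower-lower⇔reach⊆ : x ∈ lower F₂ (lower F₁ X) ⇔ reach F₁ F₂ x ⊆ X
  ∈-lower-lower⇔reach⊆ = mk⇔
    (λ x∈ {z} z∈ → let y , F₂xy , F₁zy = ∈-reach⁻ F₂ x z∈ in
               ∈-lower⁻ (∈-lower⁻ x∈ F₂xy) (symE f₁ _ _ F₁zy))
    (λ reach⊆ → ∈-lower⁺ {E = F₂} λ y F₂xy → ∈-lower⁺ {E = F₁} {X = X} λ z F₁yz →
               reach⊆ (∈-reach⁺ F₂ x F₂xy (symE f₁ y z F₁yz)))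

module _ {F₁ F₂ E₁ E₂ : BRel n} (f₁ : IsEquivRel F₁) (e₁ : IsEquivRel E₁) where

  open Equivalence

  lowerLower≡⇒SameReach : (∀ X → lower F₂ (lower F₁ X) ≡ lower E₂ (lower E₁ X)) →
                           SameReach F₁ F₂ E₁ E₂
  lowerLower≡⇒SameReach eq x = ⊆-antisym (reachBelow f₁ e₁ eq) (reachBelow e₁ f₁ (sym ∘ eq))
    where
    reachBelow : ∀ {G₁ G₂ H₁ H₂} → IsEquivRel G₁ → IsEquivRel H₁ →
                 (∀ X → lower G₂ (lower G₁ X) ≡ lower H₂ (lower H₁ X)) →
                 reach G₁ G₂ x ⊆ reach H₁ H₂ x
    reachBelow {G₂ = G₂} {H₁} {H₂} g₁ h₁ eqGH =
      to (∈-lower-lower⇔reach⊆ {F₂ = G₂} g₁)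
         (subst (x ∈_) (sym (eqGH X)) (from (∈-lower-lower⇔reach⊆ {F₂ = H₂} h₁ {x} {X}) id))
      where X = reach H₁ H₂ x

  SameReach⇒lowerLower≡ : SameReach F₁ F₂ E₁ E₂ →
                           ∀ X → lower F₂ (lower F₁ X) ≡ lower E₂ (lower E₁ X)
  SameReach⇒lowerLower≡ same X = ⊆-antisym
    (λ x∈ → from (∈-lower-lower⇔reach⊆ e₁)
               (subst (_⊆ X) (same _) (to (∈-lower-lower⇔reach⊆ f₁) x∈)))
    (λ x∈ → from (∈-lower-lower⇔reach⊆ f₁)
               (subst (_⊆ X) (sym (same _)) (to (∈-lower-lower⇔reach⊆ e₁) x∈)))

ReachUnique : BRel n → BRel n → Set
ReachUnique {n} E₁ E₂ = ∀ (F₁ F₂ : BRel n) → IsEquivRel F₁ → IsEquivRel F₂ →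
                        SameReach F₁ F₂ E₁ E₂ → SameRel F₁ E₁ × SameRel F₂ E₂

ReachUnique-flip : {E₁ E₂ : BRel n} → ReachUnique E₁ E₂ → ReachUnique E₂ E₁
ReachUnique-flip unique F₁ F₂ f₁ f₂ same =
  let F₂≡E₂ , F₁≡E₁ = unique F₂ F₁ f₂ f₁ (SameReach-flip same) in F₁≡E₁ , F₂≡E₂

ReachSeparates : BRel n → BRel n → Set
ReachSeparates E₁ E₂ = ∀ x y → cls E₂ x ≢ cls E₂ y → reach E₁ E₂ x ≢ reach E₁ E₂ y

MeetsSomeClassOnce : BRel n → BRel n → Set
MeetsSomeClassOnce {n} E₁ E₂ = ∀ x → Σ (Fin n) (λ z → ∣ cls E₂ x ∩ cls E₁ z ∣ ≡ 1)

module _ {E₁ E₂ : BRel n} (e₂ : IsEquivRel E₂) where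

  private
    R : BRel n
    R = kernel _≟ˢ_ (reach E₁ E₂)

    R⁺ : ∀ {u v} → reach E₁ E₂ u ≡ reach E₁ E₂ v → R u v ≡ true
    R⁺ = kernel⁺ _≟ˢ_ (reach E₁ E₂)

    R⁻ : ∀ {u v} → R u v ≡ true → reach E₁ E₂ u ≡ reach E₁ E₂ v
    R⁻ = kernel⁻ _≟ˢ_ (reach E₁ E₂)

  reach-kernel : SameReach E₁ (kernel _≟ˢ_ (reach E₁ E₂)) E₁ E₂
  reach-kernel x =
    ⊆-antisym below (reach-mono E₁ E₂ R (λ E₂xy → R⁺ (reach-cong {F₁ = E₁} e₂ E₂xy)) x)
    where
    below : reach E₁ R x ⊆ reach E₁ E₂ x
    below {z} z∈ = let y , Rxy , E₁zy = ∈-reach⁻ R x z∈ in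
      subst (z ∈_) (sym (R⁻ Rxy)) (∈-reach⁺ E₂ y (reflE e₂ y) E₁zy)

ReachUnique⇒ReachSeparates : {E₁ E₂ : BRel n} → IsEquivRel E₁ → IsEquivRel E₂ →
                             ReachUnique E₁ E₂ → ReachSeparates E₁ E₂
ReachUnique⇒ReachSeparates {E₁ = E₁} {E₂} e₁ e₂ unique x y cls≢ reach≡ =
  cls≢ (cls-cong e₂ (subst (_≡ true) (same x y) (kernel⁺ _≟ˢ_ (reach E₁ E₂) reach≡)))
  where
  same : SameRel (kernel _≟ˢ_ (reach E₁ E₂)) E₂
  same = proj₂ (unique E₁ _ e₁ (kernel-isEquiv _≟ˢ_ (reach E₁ E₂)) (reach-kernel e₂))

module Split {E₁ E₂ : BRel n} (e₁ : IsEquivRel E₁) (e₂ : IsEquivRel E₂) (x : Fin n)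
             (noneOnce : ∀ z → ∣ cls E₂ x ∩ cls E₁ z ∣ ≢ 1) where

  Least : Fin n → Set
  Least u = E₂ x u ≡ true × (∀ v → v < u → E₂ x v ≡ true → E₁ v u ≢ true)

  least? : ∀ u → Dec (Least u)
  least? u = E₂ x u ≟ᵇ true
       ×-dec all? (λ v → v <? u →-dec E₂ x v ≟ᵇ true →-dec ¬? (E₁ v u ≟ᵇ true))

  least-unique : ∀ {u v} → Least u → Least v → E₁ u v ≡ true → u ≡ v
  least-unique {u} {v} (xu , minU) (xv , minV) E₁uv with <-cmp u v
  ... | tri< u<v _ _ = contradiction E₁uv (minV u u<v xu)
  ... | tri≈ _ u≡v _ = u≡v
  ... | tri> _ _ v<u = contradiction (symE e₁ u v E₁uv) (minU v v<u xv)

  least-in-trace : ∀ {y} → E₂ x y ≡ true → ∃ λ m → Least m × E₁ y m ≡ true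
  least-in-trace {y} xy with least (λ v → (E₂ x v ≟ᵇ true) ×-dec (E₁ v y ≟ᵇ true)) (xy , reflE e₁ y)
  ... | m , (xm , my) , below =
    m , (xm , λ v v<m xv vm → below v<m (xv , transE e₁ v m y vm my)) , symE e₁ m y my

  nonLeast-in-trace : ∀ {y} → E₂ x y ≡ true → ∃ λ m′ → ¬ Least m′ × E₂ x m′ ≡ true × E₁ y m′ ≡ true
  nonLeast-in-trace {y} xy with least-in-trace xy
  ... | m , leastM , ym
    with ∣p∣≢1⇒∈-≢ (noneOnce m) (x∈p∩q⁺ (∈-tabulate⁺ (proj₁ leastM) , ∈-tabulate⁺ (reflE e₁ m)))
  ...   | m′ , m′∈ , m′≢m =
    m′ , (λ leastM′ → m′≢m (least-unique leastM′ leastM (symE e₁ m m′ mm′)))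
       , xm′ , transE e₁ y m m′ ym mm′
    where
    xm′ : E₂ x m′ ≡ true
    xm′ = ∈-tabulate⁻ (proj₁ (x∈p∩q⁻ (cls E₂ x) (cls E₁ m) m′∈))
    mm′ : E₁ m m′ ≡ true
    mm′ = ∈-tabulate⁻ (proj₂ (x∈p∩q⁻ (cls E₂ x) (cls E₁ m) m′∈))

  isLeast : Fin n → Bool
  isLeast u = does (least? u)

  trace-point-with-isLeast : ∀ {v} → E₂ x v ≡ true → ∀ b →
    ∃ λ w → E₂ x w ≡ true × E₁ v w ≡ true × isLeast w ≡ b
  trace-point-with-isLeast xv true with least-in-trace xv
  ... | m , leastM , vm = m , proj₁ leastM , vm , dec-true (least? m) leastM
  trace-point-with-isLeast xv false with nonLeast-in-trace xv
  ... | m′ , ¬leastM′ , xm′ , vm′ = m′ , xm′ , vm′ , dec-false (least? m′) ¬leastM′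

  F₂ : BRel n
  F₂ u v = E₂ u v ∧ kernel _≟ᵇ_ isLeast u v

  F₂-isEquiv : IsEquivRel F₂
  F₂-isEquiv = ∧-isEquiv e₂ (kernel-isEquiv _≟ᵇ_ isLeast)

  F₂⁺ : ∀ {u v} → E₂ u v ≡ true → isLeast u ≡ isLeast v → F₂ u v ≡ true
  F₂⁺ uv same = ∧-true⁺ uv (kernel⁺ _≟ᵇ_ isLeast same)

  F₂-step : ∀ {u v} → E₂ u v ≡ true → ∃ λ w → F₂ u w ≡ true × E₁ v w ≡ true
  F₂-step {u} {v} uv = stepBy (E₂ x u ≟ᵇ true)
    where
    stepBy : Dec (E₂ x u ≡ true) → ∃ λ w → F₂ u w ≡ true × E₁ v w ≡ true
    stepBy (yes xu) =
      let w , xw , vw , leastness = trace-point-with-isLeast (transE e₂ x u v xu uv) (isLeast u)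
      in w , F₂⁺ (transE e₂ u x w (symE e₂ x u xu) xw) (sym leastness) , vw
    stepBy (no ¬xu) = v , F₂⁺ uv (trans (notLeast ¬xu) (sym (notLeast ¬xv))) , reflE e₁ v
      where
      notLeast : ∀ {w} → E₂ x w ≢ true → isLeast w ≡ false
      notLeast ¬xw = dec-false (least? _) (¬xw ∘ proj₁)
      ¬xv : E₂ x v ≢ true
      ¬xv xv = ¬xu (transE e₂ x v u xv (symE e₂ u v uv))

  reach-F₂ : SameReach E₁ F₂ E₁ E₂
  reach-F₂ u =
    ⊆-antisym (reach-mono E₁ F₂ E₂ (λ {u} {v} F₂uv → proj₁ (∧-true⁻ {E₂ u v} F₂uv)) u) above
    where
    above : reach E₁ E₂ u ⊆ reach E₁ F₂ u
    above z∈ with ∈-reach⁻ E₂ u z∈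
    ... | v , uv , zv with F₂-step uv
    ...   | w , F₂uw , vw = ∈-reach⁺ F₂ u F₂uw (transE e₁ _ v w zv vw)

  ¬ReachUnique : ¬ ReachUnique E₁ E₂
  ¬ReachUnique unique with trace-point-with-isLeast (reflE e₂ x) true
                         | trace-point-with-isLeast (reflE e₂ x) false
  ... | w , xw , _ , least-w | w′ , xw′ , _ , notLeast-w′ =
    contradiction (trans (sym least-w) (trans sameLeastness notLeast-w′)) λ ()
    where
    F₂≡E₂ : SameRel F₂ E₂
    F₂≡E₂ = proj₂ (unique E₁ F₂ e₁ F₂-isEquiv reach-F₂)
    sameLeastness : isLeast w ≡ isLeast w′
    sameLeastness = kernel⁻ _≟ᵇ_ isLeast (proj₂ (∧-true⁻ {E₂ w w′}
      (trans (F₂≡E₂ w w′) (transE e₂ w x w′ (symE e₂ x w xw) xw′))))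

ReachUnique⇒MeetsSomeClassOnce : {E₁ E₂ : BRel n} → IsEquivRel E₁ → IsEquivRel E₂ →
                                  ReachUnique E₁ E₂ → MeetsSomeClassOnce E₁ E₂
ReachUnique⇒MeetsSomeClassOnce {E₁ = E₁} {E₂} e₁ e₂ unique x
  with any? (λ z → ∣ cls E₂ x ∩ cls E₁ z ∣ ≟ℕ 1)
... | yes once = once
... | no ¬once = contradiction unique (Split.¬ReachUnique e₁ e₂ x (λ z once → ¬once (z , once)))

module _ {E₁ E₂ F₁ F₂ : BRel n} (same : SameReach F₁ F₂ E₁ E₂) where

  ReachSeparates⇒⊆ : IsEquivRel E₂ → IsEquivRel F₂ → ReachSeparates E₁ E₂ → F₂ ⊆ᴿ E₂
  ReachSeparates⇒⊆ e₂ f₂ separates {u} {v} F₂uv =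
    cls-injective e₂ (decidable-stable (cls E₂ u ≟ˢ cls E₂ v) λ cls≢ → separates u v cls≢ (begin
      reach E₁ E₂ u  ≡⟨ same u ⟨
      reach F₁ F₂ u  ≡⟨ reach-cong f₂ F₂uv ⟩
      reach F₁ F₂ v  ≡⟨ same v ⟩
      reach E₁ E₂ v  ∎))
    where open ≡-Reasoning

  MeetsSomeClassOnce⇒⊇ : IsEquivRel E₁ → IsEquivRel E₂ → IsEquivRel F₂ → F₁ ⊆ᴿ E₁ → F₂ ⊆ᴿ E₂ →
                          MeetsSomeClassOnce E₁ E₂ → E₂ ⊆ᴿ F₂
  MeetsSomeClassOnce⇒⊇ e₁ e₂ f₂ F₁⊆E₁ F₂⊆E₂ once {u} {v} uv with once u
  ... | z , ∣trace∣≡1 with ∣p∣≡1⇒p≡⁅x⁆ {p = cls E₂ u ∩ cls E₁ z} ∣trace∣≡1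
  ... | w , trace≡⁅w⁆ = transE f₂ u w v (toW (reflE e₂ u)) (symE f₂ v w (toW uv))
    where
    in-trace⇒≡w : ∀ {y} → E₂ u y ≡ true → E₁ z y ≡ true → y ≡ w
    in-trace⇒≡w uy zy = x∈⁅y⁆⇒x≡y w (subst (_ ∈_) trace≡⁅w⁆
      (x∈p∩q⁺ {p = cls E₂ u} {q = cls E₁ z} (∈-tabulate⁺ uy , ∈-tabulate⁺ zy)))
    w-in-trace : E₂ u w ≡ true × E₁ z w ≡ true
    w-in-trace = let uw , zw = x∈p∩q⁻ (cls E₂ u) (cls E₁ z) (subst (w ∈_) (sym trace≡⁅w⁆) (x∈⁅x⁆ w))
                 in ∈-tabulate⁻ uw , ∈-tabulate⁻ zw
    toW : ∀ {c} → E₂ u c ≡ true → F₂ c w ≡ true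
    toW {c} uc with ∈-reach⁻ F₂ c (subst (w ∈_) (sym (same c)) w∈reach)
      where
      w∈reach : w ∈ reach E₁ E₂ c
      w∈reach = ∈-reach⁺ E₂ c (transE e₂ c u w (symE e₂ u c uc) (proj₁ w-in-trace)) (reflE e₁ w)
    ... | y , cy , wy = subst (λ t → F₂ c t ≡ true) y≡w cy
      where
      y≡w : y ≡ w
      y≡w = in-trace⇒≡w (transE e₂ u c y uc (F₂⊆E₂ cy))
                        (transE e₁ z w y (proj₂ w-in-trace) (F₁⊆E₁ wy))

conditions⇒ReachUnique : {E₁ E₂ : BRel n} → IsEquivRel E₁ → IsEquivRel E₂ →
                         ReachSeparates E₁ E₂ → ReachSeparates E₂ E₁ →
                         MeetsSomeClassOnce E₁ E₂ → MeetsSomeClassOnce E₂ E₁ → ReachUnique E₁ E₂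
conditions⇒ReachUnique {E₁ = E₁} {E₂} e₁ e₂ sep₂ sep₁ once₂ once₁ F₁ F₂ f₁ f₂ same =
  ⊆ᴿ-antisym F₁⊆E₁ (MeetsSomeClassOnce⇒⊇ (SameReach-flip same) e₂ e₁ f₁ F₂⊆E₂ F₁⊆E₁ once₁) ,
  ⊆ᴿ-antisym F₂⊆E₂ (MeetsSomeClassOnce⇒⊇ same e₁ e₂ f₂ F₁⊆E₁ F₂⊆E₂ once₂)
  where
  F₂⊆E₂ : F₂ ⊆ᴿ E₂
  F₂⊆E₂ = ReachSeparates⇒⊆ same e₂ f₂ sep₂
  F₁⊆E₁ : F₁ ⊆ᴿ E₁
  F₁⊆E₁ = ReachSeparates⇒⊆ (SameReach-flip same) e₁ f₁ sep₁

mainTheorem1 : (n : ℕ) → (T : Subset (suc n) → Subset (suc n))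
    → (E₁ E₂ : BRel (suc n)) → IsEquivRel E₁ → IsEquivRel E₂
    → (∀ X → T X ≡ lower E₂ (lower E₁ X))
    → ((∀ (F₁ F₂ : BRel (suc n)) → IsEquivRel F₁ → IsEquivRel F₂
          → (∀ X → T X ≡ lower F₂ (lower F₁ X))
          → SameRel F₁ E₁ × SameRel F₂ E₂)
       ⇔ ((∀ x y → cls E₂ x ≢ cls E₂ y → upper E₁ (cls E₂ x) ≢ upper E₁ (cls E₂ y))
          × (∀ x y → cls E₁ x ≢ cls E₁ y → upper E₂ (cls E₁ x) ≢ upper E₂ (cls E₁ y))
          × (∀ x → Σ (Fin (suc n)) (λ z → ∣ cls E₂ x ∩ cls E₁ z ∣ ≡ 1))
          × (∀ x → Σ (Fin (suc n)) (λ z → ∣ cls E₁ x ∩ cls E₂ z ∣ ≡ 1))))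
mainTheorem1 n T E₁ E₂ e₁ e₂ T≡ = mk⇔
  (λ uniqueT → let unique = fromT uniqueT ; unique′ = ReachUnique-flip unique in
      ReachUnique⇒ReachSeparates e₁ e₂ unique
    , ReachUnique⇒ReachSeparates e₂ e₁ unique′
    , ReachUnique⇒MeetsSomeClassOnce e₁ e₂ unique
    , ReachUnique⇒MeetsSomeClassOnce e₂ e₁ unique′)
  (λ (sep₂ , sep₁ , once₂ , once₁) F₁ F₂ f₁ f₂ T≡F →
      conditions⇒ReachUnique {E₁ = E₁} {E₂} e₁ e₂ sep₂ sep₁ once₂ once₁ F₁ F₂ f₁ f₂
        (lowerLower≡⇒SameReach {F₂ = F₂} {E₂ = E₂} f₁ e₁ (λ X → trans (sym (T≡F X)) (T≡ X))))
  where
  fromT : (∀ F₁ F₂ → IsEquivRel F₁ → IsEquivRel F₂ → (∀ X → T X ≡ lower F₂ (lower F₁ X)) →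
           SameRel F₁ E₁ × SameRel F₂ E₂) → ReachUnique E₁ E₂
  fromT uniqueT F₁ F₂ f₁ f₂ same =
    uniqueT F₁ F₂ f₁ f₂
      (λ X → trans (T≡ X) (sym (SameReach⇒lowerLower≡ {F₂ = F₂} {E₂ = E₂} f₁ e₁ same X)))
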